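{- Let $d\geq 1$ and let $G$ be a finite simple $d$-regular graph that is Vizing-class-1 (i.e. $\chi'(G)=d$). Then every proper edge coloring $c:E(G)\rightarrow\{1,2,\ldots,d\}$ is an additive edge coloring of $G$. Consequently $\eta_p'(G)=\chi'(G)=d$, and in particular $\eta(L(G))\leq \chi(L(G))$, where $L(G)$ is the line graph of $G$.
   Context: All graphs are finite, with no loops and no parallel edges. For an edge $e$ of $G$, $N'(e)$ denotes the set of edges of $G$ other than $e$ that share an endpoint with $e$. An additive edge coloring of $G$ is a function $c:E(G)\rightarrow\mathbb{N}$ (positive integers) such that for any two edges $e_1,e_2$ sharing an endpoint, $\sum_{e\in N'(e_1)}c(e)\neq\sum_{e\in N'(e_2)}c(e)$; equivalently, an additive coloring of the line graph $L(G)$, where an additive coloring of a graph $H$ is a map $c:V(H)\to\mathbb{N}$ with $\sum_{u\in N(v)}c(u)\neq\sum_{u\in N(w)}c(u)$ for all adjacent $v,w$. A proper additive edge coloring is an additive edge coloring that is also a proper edge coloring. $\eta_p'(G)$ is the least $k$ such that $G$ has a proper additive edge coloring with labels in $\{1,\ldots,k\}$; $\eta(H)$ is the least $k$ such that $H$ has an additive coloring with labels in $\{1,\dots,k\}$. $\chi'(G)$ is the chromatic index and $\chi$ the chromatic number. A $d$-regular graph is Vizing-class-1 if $\chi'(G)=d$. -}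

module Defs where

open import Data.Nat using (ℕ; _≤_; _<ᵇ_)
open import Data.Nat.Properties using ()
open import Data.Bool using (Bool; true; false; _∧_; _∨_; not; T)
open import Data.Fin using (Fin; toℕ; _≟_)
open import Data.List using (List; []; _∷_; filterᵇ; map; length; allFin; concatMap)
open import Data.Nat.ListAction using (sum)
open import Data.Product using (Σ; Σ-syntax; ∃-syntax; _×_; _,_; proj₁; proj₂)
open import Relation.Nullary using (¬_; yes; no)
open import Relation.Nullary.Decidable using (⌊_⌋; T?)
open import Relation.Binary.PropositionalEquality using (_≡_; _≢_)

IsLeast : (ℕ → Set) → ℕ → Set
IsLeast P k = P k × (∀ j → P j → k ≤ j)

record SimpleGraph (n : ℕ) : Set where
  field
    adj    : Fin n → Fin n → Bool
    sym    : ∀ u v → adj u v ≡ adj v u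
    irrefl : ∀ v → adj v v ≡ false
open SimpleGraph public

degree : ∀ {n} → SimpleGraph n → Fin n → ℕ
degree {n} G v = length (filterᵇ (adj G v) (allFin n))

Regular : ∀ {n} → ℕ → SimpleGraph n → Set
Regular {n} d G = ∀ (v : Fin n) → degree G v ≡ d

-- An edge {u,v} is represented uniquely as (u , v) with u < v.
isEdge : ∀ {n} → SimpleGraph n → Fin n → Fin n → Bool
isEdge G u v = (toℕ u <ᵇ toℕ v) ∧ adj G u v

Edge : ∀ {n} → SimpleGraph n → Set
Edge {n} G = Σ[ u ∈ Fin n ] Σ[ v ∈ Fin n ] T (isEdge G u v)

pickEdge : ∀ {n} (G : SimpleGraph n) → Fin n → Fin n → List (Edge G)
pickEdge G u v with T? (isEdge G u v)
... | yes p = (u , v , p) ∷ []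
... | no _  = []

edges : ∀ {n} (G : SimpleGraph n) → List (Edge G)
edges {n} G = concatMap (λ u → concatMap (λ v → pickEdge G u v) (allFin n)) (allFin n)

src tgt : ∀ {n} {G : SimpleGraph n} → Edge G → Fin n
src {G = G} e = proj₁ e
tgt {G = G} e = proj₁ (proj₂ e)

eqᵇ : ∀ {n} → Fin n → Fin n → Bool
eqᵇ a b = ⌊ a ≟ b ⌋

sameEdge : ∀ {n} {G : SimpleGraph n} → Edge G → Edge G → Bool
sameEdge {G = G} e f = eqᵇ (src {G = G} e) (src {G = G} f) ∧ eqᵇ (tgt {G = G} e) (tgt {G = G} f)

shareEndpoint : ∀ {n} {G : SimpleGraph n} → Edge G → Edge G → Bool
shareEndpoint {G = G} e f =
  eqᵇ (src {G = G} e) (src {G = G} f) ∨ eqᵇ (src {G = G} e) (tgt {G = G} f)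
  ∨ eqᵇ (tgt {G = G} e) (src {G = G} f) ∨ eqᵇ (tgt {G = G} e) (tgt {G = G} f)

edgeAdj : ∀ {n} {G : SimpleGraph n} → Edge G → Edge G → Bool
edgeAdj {G = G} e f = shareEndpoint {G = G} e f ∧ not (sameEdge {G = G} e f)

N' : ∀ {n} (G : SimpleGraph n) → Edge G → List (Edge G)
N' G e = filterᵇ (edgeAdj {G = G} e) (edges G)

EdgeLabelsIn : ∀ {n} {G : SimpleGraph n} → ℕ → (Edge G → ℕ) → Set
EdgeLabelsIn k c = ∀ e → 1 ≤ c e × c e ≤ k

ProperEdgeColoring : ∀ {n} (G : SimpleGraph n) → (Edge G → ℕ) → Set
ProperEdgeColoring G c = ∀ e f → T (edgeAdj {G = G} e f) → c e ≢ c f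

AdditiveEdgeColoring : ∀ {n} (G : SimpleGraph n) → (Edge G → ℕ) → Set
AdditiveEdgeColoring G c =
  ∀ e f → T (edgeAdj {G = G} e f) → sum (map c (N' G e)) ≢ sum (map c (N' G f))

EdgeColorable : ∀ {n} → SimpleGraph n → ℕ → Set
EdgeColorable G k = ∃[ c ] (EdgeLabelsIn {G = G} k c × ProperEdgeColoring G c)

ProperAdditiveEdgeColorable : ∀ {n} → SimpleGraph n → ℕ → Set
ProperAdditiveEdgeColorable G k =
  ∃[ c ] (EdgeLabelsIn {G = G} k c × ProperEdgeColoring G c × AdditiveEdgeColoring G c)

ChromaticIndexIs : ∀ {n} → SimpleGraph n → ℕ → Set
ChromaticIndexIs G = IsLeast (EdgeColorable G)

ProperAdditiveIndexIs : ∀ {n} → SimpleGraph n → ℕ → Set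
ProperAdditiveIndexIs G = IsLeast (ProperAdditiveEdgeColorable G)

record FinGraph : Set₁ where
  field
    V     : Set
    verts : List V
    Adj   : V → V → Bool
open FinGraph public

nbrs : (H : FinGraph) → V H → List (V H)
nbrs H v = filterᵇ (Adj H v) (verts H)

LabelsIn : (H : FinGraph) → ℕ → (V H → ℕ) → Set
LabelsIn H k c = ∀ v → 1 ≤ c v × c v ≤ k

Colorable : FinGraph → ℕ → Set
Colorable H k = ∃[ c ] (LabelsIn H k c × (∀ v w → T (Adj H v w) → c v ≢ c w))

AdditiveColorable : FinGraph → ℕ → Set
AdditiveColorable H k =
  ∃[ c ] (LabelsIn H k c ×
    (∀ v w → T (Adj H v w) → sum (map c (nbrs H v)) ≢ sum (map c (nbrs H w))))

ChromaticNumberIs : FinGraph → ℕ → Set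
ChromaticNumberIs H = IsLeast (Colorable H)

AdditiveNumberIs : FinGraph → ℕ → Set
AdditiveNumberIs H = IsLeast (AdditiveColorable H)

LineGraph : ∀ {n} → SimpleGraph n → FinGraph
LineGraph G = record { V = Edge G ; verts = edges G ; Adj = edgeAdj {G = G} }

module Submission where

-- For an edge e = uv, every edge adjacent to e meets exactly one of u and v, so
--   Σ_{N'(e)} c + 2 c(e) = S(u) + S(v),   where S(w) is the sum of the colours at w.
-- In a d-regular graph a proper colouring by {1, …, d} uses every colour exactly once at each vertex,
-- so S(w) = 1 + ⋯ + d for all w. Hence Σ_{N'(e)} c = d(d + 1) − 2 c(e), which differs for adjacent
-- edges since their colours differ. With χ'(G) = d this gives η'_p(G) = d, and as a proper colouring of
-- L(G) is a proper edge colouring of G, η(L(G)) ≤ d = χ(L(G)).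

open import Defs hiding (sym)
open import Data.Nat using (ℕ; _≤_)
open import Data.Product using (_×_)

open import Data.Bool using (Bool; true; false; _∧_; _∨_; not; T; if_then_else_)
open import Data.Bool.Properties using (T-∧; T-∨; T-irrelevant)
open import Data.Fin using (Fin; toℕ; _≟_)
open import Data.Fin.Properties using (toℕ-injective)
open import Data.List using (List; []; _∷_; _++_; filterᵇ; map; length; allFin; concatMap)
open import Data.List.Membership.Propositional using (_∈_; _∉_)
open import Data.List.Membership.Propositional.Properties using (∈-allFin; ∈-∃++)
open import Data.List.Membership.DecPropositional Data.Nat._≟_ using (_∈?_)
open import Data.List.Properties using (map-++; map-cong; length-map)
open import Data.List.Relation.Binary.Permutation.Propositional using (_↭_; ↭⇒↭ₛ)
open import Data.List.Relation.Binary.Permutation.Propositional.Properties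
  using (All-resp-↭; ↭-length; shift)
open import Data.List.Relation.Unary.All as All using (All; []; _∷_)
open import Data.List.Relation.Unary.All.Properties using (all-filter) renaming (map⁺ to all-map⁺)
open import Data.List.Relation.Unary.AllPairs using (AllPairs; []; _∷_)
import Data.List.Relation.Unary.AllPairs.Properties as AllPairs
open import Data.List.Relation.Unary.Any using (here; there)
open import Data.List.Relation.Unary.Unique.Propositional using (Unique)
open import Data.List.Relation.Unary.Unique.Propositional.Properties as Unique
  using (allFin⁺; Unique[x∷xs]⇒x∉xs)
open import Data.Nat using (zero; suc; _+_; _*_; _<_; z≤n; s≤s)
open import Data.Nat.ListAction using (sum)
open import Data.Nat.ListAction.Properties using (sum-++; sum-↭)
open import Data.Nat.Properties
  using (+-identityʳ; +-cancelˡ-≡; *-cancelˡ-≡; ≤-pred; ≤∧≢⇒<; m≤n⇒m≤1+n; 1+n≰n; suc-injective;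
         <-cmp; <-irrefl; <-asym; <⇒<ᵇ; <ᵇ⇒<; <⇒≢; ≤-trans; +-commutativeSemigroup)
open import Algebra.Properties.CommutativeSemigroup +-commutativeSemigroup using (interchange)
open import Data.Product using (∃-syntax; _,_; proj₁; proj₂)
open import Data.Sum using (_⊎_; inj₁; inj₂)
import Data.Sum as Sum
open import Function using (_∘_; Equivalence)
open import Relation.Binary using (tri<; tri≈; tri>)
open import Relation.Binary.PropositionalEquality
  using (_≡_; _≢_; refl; sym; trans; cong; cong₂; subst; setoid; module ≡-Reasoning)
open import Data.List.Relation.Binary.Permutation.Setoid.Properties (setoid ℕ) using (Unique-resp-↭)
open import Relation.Nullary using (¬_; yes; no; contradiction)
open import Relation.Nullary.Decidable using (T?; toWitness; fromWitness)

open Equivalence using (to; from)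

triangular : ℕ → ℕ
triangular zero    = 0
triangular (suc d) = suc d + triangular d

InRange : ℕ → List ℕ → Set
InRange d = All (λ x → 1 ≤ x × x ≤ d)

∈⇒↭∷ : ∀ {A : Set} {x : A} {xs} → x ∈ xs → ∃[ ys ] xs ↭ x ∷ ys
∈⇒↭∷ {x = x} x∈xs with ys , zs , refl ← ∈-∃++ x∈xs = ys ++ zs , shift x ys zs

InRange-lower : ∀ {d xs} → suc d ∉ xs → InRange (suc d) xs → InRange d xs
InRange-lower _     []                      = []
InRange-lower top∉ ((1≤x , x≤1+d) ∷ inRange) =
  (1≤x , ≤-pred (≤∧≢⇒< x≤1+d (top∉ ∘ here ∘ sym))) ∷ InRange-lower (top∉ ∘ there) inRange

remove-top : ∀ {d xs} → Unique xs → InRange (suc d) xs → suc d ∈ xs →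
             ∃[ ys ] xs ↭ suc d ∷ ys × Unique ys × InRange d ys
remove-top distinct inRange top∈ with ys , xs↭ ← ∈⇒↭∷ top∈
  with top∷ys@(_ ∷ distinct′) ← Unique-resp-↭ (↭⇒↭ₛ xs↭) distinct
  with _ ∷ inRange′ ← All-resp-↭ xs↭ inRange =
  ys , xs↭ , distinct′ , InRange-lower (Unique[x∷xs]⇒x∉xs top∷ys) inRange′

length-distinct-in-range : ∀ d {xs} → Unique xs → InRange d xs → length xs ≤ d
length-distinct-in-range zero    {[]} _ _              = z≤n
length-distinct-in-range zero    {_ ∷ _} _ ((s≤s _ , ()) ∷ _)
length-distinct-in-range (suc d) {xs} distinct inRange with suc d ∈? xs
... | no top∉ = m≤n⇒m≤1+n (length-distinct-in-range d distinct (InRange-lower top∉ inRange))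
... | yes top∈ with ys , xs↭ , distinct′ , inRange′ ← remove-top distinct inRange top∈ =
  subst (_≤ suc d) (sym (↭-length xs↭)) (s≤s (length-distinct-in-range d distinct′ inRange′))

sum-distinct-in-range : ∀ d {xs} → Unique xs → InRange d xs → length xs ≡ d → sum xs ≡ triangular d
sum-distinct-in-range zero    {[]} _ _ _ = refl
sum-distinct-in-range (suc d) {xs} distinct inRange len with suc d ∈? xs
... | no top∉ =
  contradiction (subst (_≤ d) len (length-distinct-in-range d distinct (InRange-lower top∉ inRange))) 1+n≰n
... | yes top∈ with ys , xs↭ , distinct′ , inRange′ ← remove-top distinct inRange top∈ = begin
  sum xs               ≡⟨ sum-↭ xs↭ ⟩
  suc d + sum ys       ≡⟨ cong (suc d +_) (sum-distinct-in-range d distinct′ inRange′ len′) ⟩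
  triangular (suc d)   ∎
  where
  open ≡-Reasoning
  len′ : length ys ≡ d
  len′ = suc-injective (trans (sym (↭-length xs↭)) len)

+-double-injective : ∀ {m n} → m + m ≡ n + n → m ≡ n
+-double-injective {m} {n} eq = *-cancelˡ-≡ m n 2 (begin
  2 * m   ≡⟨ cong (m +_) (+-identityʳ m) ⟩
  m + m   ≡⟨ eq ⟩
  n + n   ≡⟨ cong (n +_) (+-identityʳ n) ⟨
  2 * n   ∎)
  where open ≡-Reasoning

when : Bool → ℕ → ℕ
when b k = if b then k else 0

when-zero : ∀ b → when b 0 ≡ 0
when-zero true  = refl
when-zero false = refl

when-∧ : ∀ a b k → when (a ∧ b) k ≡ when a (when b k)
when-∧ true  _ _ = refl
when-∧ false _ _ = refl

when-∨ : ∀ a b {k} → (T (a ∧ b) → k ≡ 0) → when (a ∨ b) k ≡ when a k + when b k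
when-∨ true  true  k≡0 = trans (k≡0 _) (cong₂ _+_ (sym (k≡0 _)) (sym (k≡0 _)))
when-∨ true  false _   = sym (+-identityʳ _)
when-∨ false _     _   = refl

when-self : ∀ b {k} → (¬ T b → k ≡ 0) → when b k ≡ k
when-self true  _   = refl
when-self false k≡0 = sym (k≡0 λ ())

T-not : ∀ {b} → ¬ T b → T (not b)
T-not {false} _  = _
T-not {true}  ¬t = ¬t _

T-eqᵇ∧eqᵇ : ∀ {n} (a b c d : Fin n) → T (eqᵇ a b ∧ eqᵇ c d) → a ≡ b × c ≡ d
T-eqᵇ∧eqᵇ a b c d t with a≡b , c≡d ← to (T-∧ {eqᵇ a b} {eqᵇ c d}) t =
  toWitness {a? = a ≟ b} a≡b , toWitness {a? = c ≟ d} c≡d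

T-∨₄ : ∀ {a b c d} → T a ⊎ T b ⊎ T c ⊎ T d → T (a ∨ b ∨ c ∨ d)
T-∨₄ = from T-∨ ∘ Sum.map₂ (from T-∨ ∘ Sum.map₂ (from T-∨))

-- For edges e = (u , v) and f = (x , y), with a, b, c, d standing for u = x, u = y, v = x, v = y, this is
-- [f adjacent to e] + 2 [f = e] = [u ∈ f] + [v ∈ f]; the hypotheses exclude coincidences impossible when u < v, x < y.
when-adjacent : ∀ a b c d k → ¬ T (a ∧ c) → ¬ T (b ∧ d) → ¬ T (b ∧ c) →
  when ((a ∨ b ∨ c ∨ d) ∧ not (a ∧ d)) k + (when (a ∧ d) k + when (a ∧ d) k) ≡ when (a ∨ b) k + when (c ∨ d) k
when-adjacent true  true  true  _     _ ¬ac _   _   = contradiction _ ¬ac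
when-adjacent true  true  false true  _ _   ¬bd _   = contradiction _ ¬bd
when-adjacent true  true  false false _ _   _   _   = refl
when-adjacent true  false true  _     _ ¬ac _   _   = contradiction _ ¬ac
when-adjacent true  false false true  _ _   _   _   = refl
when-adjacent true  false false false _ _   _   _   = refl
when-adjacent false true  true  _     _ _   _   ¬bc = contradiction _ ¬bc
when-adjacent false true  false true  _ _   ¬bd _   = contradiction _ ¬bd
when-adjacent false true  false false _ _   _   _   = refl
when-adjacent false false true  _     k _   _   _   = +-identityʳ k
when-adjacent false false false true  k _   _   _   = +-identityʳ k
when-adjacent false false false false _ _   _   _   = refl

module _ {A : Set} where

  sum-map-cong : ∀ {f g : A → ℕ} → (∀ x → f x ≡ g x) → ∀ xs → sum (map f xs) ≡ sum (map g xs)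
  sum-map-cong f≗g xs = cong sum (map-cong f≗g xs)

  sum-map-+ : ∀ (f g : A → ℕ) xs → sum (map (λ x → f x + g x) xs) ≡ sum (map f xs) + sum (map g xs)
  sum-map-+ f g []       = refl
  sum-map-+ f g (x ∷ xs) = trans (cong (f x + g x +_) (sum-map-+ f g xs))
                                 (interchange (f x) (g x) (sum (map f xs)) (sum (map g xs)))

  sum-map-when : ∀ b (f : A → ℕ) xs → sum (map (λ x → when b (f x)) xs) ≡ when b (sum (map f xs))
  sum-map-when true  f xs       = refl
  sum-map-when false f []       = refl
  sum-map-when false f (_ ∷ xs) = sum-map-when false f xs

  sum-map-filterᵇ : ∀ (p : A → Bool) (f : A → ℕ) xs →
                    sum (map f (filterᵇ p xs)) ≡ sum (map (λ x → when (p x) (f x)) xs)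
  sum-map-filterᵇ p f []       = refl
  sum-map-filterᵇ p f (x ∷ xs) with p x
  ... | true  = cong (f x +_) (sum-map-filterᵇ p f xs)
  ... | false = sum-map-filterᵇ p f xs

  sum-map-concatMap : ∀ {B : Set} (f : B → ℕ) (g : A → List B) xs →
                      sum (map f (concatMap g xs)) ≡ sum (map (λ x → sum (map f (g x))) xs)
  sum-map-concatMap f g []       = refl
  sum-map-concatMap f g (x ∷ xs) = begin
    sum (map f (g x ++ concatMap g xs))              ≡⟨ cong sum (map-++ f (g x) _) ⟩
    sum (map f (g x) ++ map f (concatMap g xs))      ≡⟨ sum-++ (map f (g x)) _ ⟩
    sum (map f (g x)) + sum (map f (concatMap g xs)) ≡⟨ cong (_ +_) (sum-map-concatMap f g xs) ⟩
    sum (map (λ x → sum (map f (g x))) (x ∷ xs))     ∎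
    where open ≡-Reasoning

AllPairs-under : ∀ {A : Set} {P : A → Set} {R S : A → A → Set} →
  (∀ {x y} → P x → P y → R x y → S x y) → ∀ {xs} → All P xs → AllPairs R xs → AllPairs S xs
AllPairs-under h []         []         = []
AllPairs-under h (px ∷ pxs) (rx ∷ rxs) =
  All.zipWith (λ (py , r) → h px py r) (pxs , rx) ∷ AllPairs-under h pxs rxs

sumFin : ∀ {n} → (Fin n → ℕ) → ℕ
sumFin {n} f = sum (map f (allFin n))

module _ {n : ℕ} where

  sumFin-cong : ∀ {f g : Fin n → ℕ} → (∀ x → f x ≡ g x) → sumFin f ≡ sumFin g
  sumFin-cong f≗g = sum-map-cong f≗g (allFin n)

  sumFin-+ : ∀ (f g : Fin n → ℕ) → sumFin (λ x → f x + g x) ≡ sumFin f + sumFin g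
  sumFin-+ f g = sum-map-+ f g (allFin n)

  sumFin-when : ∀ b (f : Fin n → ℕ) → sumFin (λ x → when b (f x)) ≡ when b (sumFin f)
  sumFin-when b f = sum-map-when b f (allFin n)

module _ {n : ℕ} (w : Fin n) (f : Fin n → ℕ) where

  sum-map-when-≡-∉ : ∀ {xs} → w ∉ xs → sum (map (λ x → when (eqᵇ w x) (f x)) xs) ≡ 0
  sum-map-when-≡-∉ {[]}     _  = refl
  sum-map-when-≡-∉ {x ∷ xs} w∉ with w ≟ x
  ... | yes w≡x = contradiction (here w≡x) w∉
  ... | no  _   = sum-map-when-≡-∉ (w∉ ∘ there)

  sum-map-when-≡ : ∀ {xs} → Unique xs → w ∈ xs → sum (map (λ x → when (eqᵇ w x) (f x)) xs) ≡ f w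
  sum-map-when-≡ distinct (here refl) with w ≟ w
  ... | yes _   = trans (cong (f w +_) (sum-map-when-≡-∉ (Unique[x∷xs]⇒x∉xs distinct))) (+-identityʳ _)
  ... | no  w≢w = contradiction refl w≢w
  sum-map-when-≡ {x ∷ _} distinct@(_ ∷ distinct′) (there w∈) with w ≟ x
  ... | yes refl = contradiction w∈ (Unique[x∷xs]⇒x∉xs distinct)
  ... | no  _    = sum-map-when-≡ distinct′ w∈

  sumFin-when-≡ : sumFin (λ x → when (eqᵇ w x) (f x)) ≡ f w
  sumFin-when-≡ = sum-map-when-≡ (allFin⁺ n) (∈-allFin w)

module _ {n : ℕ} (G : SimpleGraph n) where

  isEdge-< : ∀ {x y} → T (isEdge G x y) → toℕ x < toℕ y
  isEdge-< {x} {y} = <ᵇ⇒< (toℕ x) (toℕ y) ∘ proj₁ ∘ to T-∧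

  isEdge-adj : ∀ {x y} → T (isEdge G x y) → T (adj G x y)
  isEdge-adj = proj₂ ∘ to T-∧

  isEdge-≢ : ∀ {x y} → T (isEdge G x y) → x ≢ y
  isEdge-≢ e refl = <-irrefl refl (isEdge-< e)

  -- The value of g on the edge (x , y), or 0 if x < y fails or x, y are not adjacent.
  valueAt : (Edge G → ℕ) → Fin n → Fin n → ℕ
  valueAt g x y = sum (map g (pickEdge G x y))

  valueAt-edge : ∀ g {x y} (e : T (isEdge G x y)) → valueAt g x y ≡ g (x , y , e)
  valueAt-edge g {x} {y} e with T? (isEdge G x y)
  ... | yes e′ = trans (+-identityʳ _) (cong (λ e″ → g (x , y , e″)) (T-irrelevant e′ e))
  ... | no ¬e  = contradiction e ¬e

  valueAt-nonedge : ∀ g {x y} → ¬ T (isEdge G x y) → valueAt g x y ≡ 0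
  valueAt-nonedge g {x} {y} ¬e with T? (isEdge G x y)
  ... | yes e = contradiction e ¬e
  ... | no _  = refl

  valueAt-when : ∀ (β : Fin n → Fin n → Bool) g x y →
    valueAt (λ f → when (β (src {G = G} f) (tgt {G = G} f)) (g f)) x y ≡ when (β x y) (valueAt g x y)
  valueAt-when β g x y with T? (isEdge G x y)
  ... | yes _ = trans (+-identityʳ _) (cong (when (β x y)) (sym (+-identityʳ _)))
  ... | no _  = sym (when-zero (β x y))

  sum-edges : ∀ g → sum (map g (edges G)) ≡ sumFin λ x → sumFin λ y → valueAt g x y
  sum-edges g = trans (sum-map-concatMap g _ (allFin n))
                      (sum-map-cong (λ x → sum-map-concatMap g _ (allFin n)) (allFin n))

  sum-edges-when : ∀ (β : Fin n → Fin n → Bool) g →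
    sum (map (λ f → when (β (src {G = G} f) (tgt {G = G} f)) (g f)) (edges G))
      ≡ sumFin λ x → sumFin λ y → when (β x y) (valueAt g x y)
  sum-edges-when β g = trans (sum-edges _) (sumFin-cong λ x → sumFin-cong (valueAt-when β g x))

  sum-sameEdge : ∀ e g → sum (map (λ f → when (sameEdge {G = G} e f) (g f)) (edges G)) ≡ g e
  sum-sameEdge e@(u , v , uv) g = begin
    _ ≡⟨ sum-edges-when (λ x y → eqᵇ u x ∧ eqᵇ v y) g ⟩
    sumFin (λ x → sumFin λ y → when (eqᵇ u x ∧ eqᵇ v y) (valueAt g x y))
      ≡⟨ sumFin-cong (λ x → trans (sumFin-cong λ y → when-∧ (eqᵇ u x) (eqᵇ v y) _)
                                 (sumFin-when (eqᵇ u x) λ y → when (eqᵇ v y) (valueAt g x y))) ⟩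
    sumFin (λ x → when (eqᵇ u x) (sumFin λ y → when (eqᵇ v y) (valueAt g x y)))
      ≡⟨ sumFin-when-≡ u _ ⟩
    sumFin (λ y → when (eqᵇ v y) (valueAt g u y)) ≡⟨ sumFin-when-≡ v _ ⟩
    valueAt g u v                                 ≡⟨ valueAt-edge g uv ⟩
    g e                                           ∎
    where open ≡-Reasoning

  incidentᵇ : Fin n → Edge G → Bool
  incidentᵇ w f = eqᵇ w (src {G = G} f) ∨ eqᵇ w (tgt {G = G} f)

  -- At most one summand is nonzero, as edges are stored with their smaller endpoint first.
  between : (Edge G → ℕ) → Fin n → Fin n → ℕ
  between g w y = valueAt g w y + valueAt g y w

  sum-incident : ∀ w g → sum (map (λ f → when (incidentᵇ w f) (g f)) (edges G)) ≡ sumFin (between g w)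
  sum-incident w g = begin
    _ ≡⟨ sum-edges-when (λ x y → eqᵇ w x ∨ eqᵇ w y) g ⟩
    sumFin (λ x → sumFin λ y → when (eqᵇ w x ∨ eqᵇ w y) (valueAt g x y))
      ≡⟨ sumFin-cong (λ x → trans (sumFin-cong λ y → when-∨ (eqᵇ w x) (eqᵇ w y) (no-loop x y))
                                 (sumFin-+ (from-w x) (to-w x))) ⟩
    sumFin (λ x → sumFin (from-w x) + sumFin (to-w x))
      ≡⟨ sumFin-+ (λ x → sumFin (from-w x)) (λ x → sumFin (to-w x)) ⟩
    sumFin (λ x → sumFin (from-w x)) + sumFin (λ x → sumFin (to-w x))
      ≡⟨ cong₂ _+_ (trans (sumFin-cong λ x → sumFin-when (eqᵇ w x) (valueAt g x)) (sumFin-when-≡ w _))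
                   (sumFin-cong λ x → sumFin-when-≡ w (valueAt g x)) ⟩
    sumFin (valueAt g w) + sumFin (λ x → valueAt g x w)
      ≡⟨ sumFin-+ (valueAt g w) (λ x → valueAt g x w) ⟨
    sumFin (between g w) ∎
    where
    open ≡-Reasoning
    from-w to-w : Fin n → Fin n → ℕ
    from-w x y = when (eqᵇ w x) (valueAt g x y)
    to-w   x y = when (eqᵇ w y) (valueAt g x y)
    no-loop : ∀ x y → T (eqᵇ w x ∧ eqᵇ w y) → valueAt g x y ≡ 0
    no-loop x y t with refl , refl ← T-eqᵇ∧eqᵇ w x w y t = valueAt-nonedge g {x} {x} (λ e → isEdge-≢ e refl)

  sum-N′ : ∀ g e → sum (map g (N' G e)) + (g e + g e)
                     ≡ sumFin (between g (src {G = G} e)) + sumFin (between g (tgt {G = G} e))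
  sum-N′ g e@(u , v , uv) = begin
    sum (map g (N' G e)) + (g e + g e)
      ≡⟨ cong₂ _+_ (sum-map-filterᵇ (edgeAdj {G = G} e) g (edges G))
                   (sym (cong₂ _+_ (sum-sameEdge e g) (sum-sameEdge e g))) ⟩
    sum (map adjacent (edges G)) + (sum (map same (edges G)) + sum (map same (edges G)))
      ≡⟨ trans (sum-map-+ adjacent (λ f → same f + same f) (edges G))
               (cong (sum (map adjacent (edges G)) +_) (sum-map-+ same same (edges G))) ⟨
    sum (map (λ f → adjacent f + (same f + same f)) (edges G))
      ≡⟨ sum-map-cong split (edges G) ⟩
    sum (map (λ f → incident u f + incident v f) (edges G))
      ≡⟨ sum-map-+ (incident u) (incident v) (edges G) ⟩
    sum (map (incident u) (edges G)) + sum (map (incident v) (edges G))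
      ≡⟨ cong₂ _+_ (sum-incident u g) (sum-incident v g) ⟩
    sumFin (between g u) + sumFin (between g v) ∎
    where
    open ≡-Reasoning
    adjacent same : Edge G → ℕ
    adjacent f = when (edgeAdj {G = G} e f) (g f)
    same     f = when (sameEdge {G = G} e f) (g f)
    incident : Fin n → Edge G → ℕ
    incident w f = when (incidentᵇ w f) (g f)

    split : ∀ f → adjacent f + (same f + same f) ≡ incident u f + incident v f
    split f@(x , y , xy) = when-adjacent (eqᵇ u x) (eqᵇ u y) (eqᵇ v x) (eqᵇ v y) (g f) ¬ac ¬bd ¬bc
      where
      ¬ac : ¬ T (eqᵇ u x ∧ eqᵇ v x)
      ¬ac t with refl , refl ← T-eqᵇ∧eqᵇ u x v x t = isEdge-≢ uv refl
      ¬bd : ¬ T (eqᵇ u y ∧ eqᵇ v y)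
      ¬bd t with refl , refl ← T-eqᵇ∧eqᵇ u y v y t = isEdge-≢ uv refl
      ¬bc : ¬ T (eqᵇ u y ∧ eqᵇ v x)
      ¬bc t with refl , refl ← T-eqᵇ∧eqᵇ u y v x t = <-asym (isEdge-< uv) (isEdge-< xy)

  adj-sym : ∀ {x y} → T (adj G x y) → T (adj G y x)
  adj-sym {x} {y} = subst T (SimpleGraph.sym G x y)

  adj-≢ : ∀ {x y} → T (adj G x y) → x ≢ y
  adj-≢ {x} a refl = subst T (SimpleGraph.irrefl G x) a

  isEdge-intro : ∀ {x y} → toℕ x < toℕ y → T (adj G x y) → T (isEdge G x y)
  isEdge-intro x<y a = from T-∧ (<⇒<ᵇ x<y , a)

  edgeBetween : ∀ w y → T (adj G w y) → Edge G
  edgeBetween w y a with <-cmp (toℕ w) (toℕ y)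
  ... | tri< w<y _ _ = w , y , isEdge-intro w<y a
  ... | tri≈ _ w≡y _ = contradiction (toℕ-injective w≡y) (adj-≢ a)
  ... | tri> _ _ y<w = y , w , isEdge-intro y<w (adj-sym a)

  between-edgeBetween : ∀ g w y (a : T (adj G w y)) → between g w y ≡ g (edgeBetween w y a)
  between-edgeBetween g w y a with <-cmp (toℕ w) (toℕ y)
  ... | tri< w<y _ _ = trans (cong₂ _+_ (valueAt-edge g _) (valueAt-nonedge g (<-asym w<y ∘ isEdge-<)))
                             (+-identityʳ _)
  ... | tri≈ _ w≡y _ = contradiction (toℕ-injective w≡y) (adj-≢ a)
  ... | tri> _ _ y<w = cong₂ _+_ (valueAt-nonedge g (<-asym y<w ∘ isEdge-<)) (valueAt-edge g _)

  between-nonadjacent : ∀ g {w y} → ¬ T (adj G w y) → between g w y ≡ 0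
  between-nonadjacent g ¬a =
    cong₂ _+_ (valueAt-nonedge g (¬a ∘ isEdge-adj)) (valueAt-nonedge g (¬a ∘ adj-sym ∘ isEdge-adj))

  Incident : Fin n → Edge G → Set
  Incident w f = w ≡ src {G = G} f ⊎ w ≡ tgt {G = G} f

  incident-edgeBetween : ∀ w y a → Incident w (edgeBetween w y a)
  incident-edgeBetween w y a with <-cmp (toℕ w) (toℕ y)
  ... | tri< _ _ _   = inj₁ refl
  ... | tri≈ _ w≡y _ = contradiction (toℕ-injective w≡y) (adj-≢ a)
  ... | tri> _ _ _   = inj₂ refl

  other : Edge G → Fin n → Fin n
  other f w = if eqᵇ (src {G = G} f) w then tgt {G = G} f else src {G = G} f

  other-edgeBetween : ∀ w y a → other (edgeBetween w y a) w ≡ y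
  other-edgeBetween w y a with <-cmp (toℕ w) (toℕ y)
  ... | tri≈ _ w≡y _ = contradiction (toℕ-injective w≡y) (adj-≢ a)
  ... | tri< _ _ _ with w ≟ w
  ...   | yes _   = refl
  ...   | no  w≢w = contradiction refl w≢w
  other-edgeBetween w y a | tri> _ _ y<w with y ≟ w
  ...   | yes y≡w = contradiction (cong toℕ y≡w) (<⇒≢ y<w)
  ...   | no  _   = refl

  edgeBetween-injective : ∀ w {y y′} a a′ → edgeBetween w y a ≡ edgeBetween w y′ a′ → y ≡ y′
  edgeBetween-injective w {y} {y′} a a′ eq = begin
    y                              ≡⟨ other-edgeBetween w y a ⟨
    other (edgeBetween w y a) w    ≡⟨ cong (λ f → other f w) eq ⟩
    other (edgeBetween w y′ a′) w  ≡⟨ other-edgeBetween w y′ a′ ⟩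
    y′                             ∎
    where open ≡-Reasoning

  sameEdge-sound : ∀ f f′ → T (sameEdge {G = G} f f′) → f ≡ f′
  sameEdge-sound (x , y , xy) (x′ , y′ , xy′) t with refl , refl ← T-eqᵇ∧eqᵇ x x′ y y′ t =
    cong (λ e → x , y , e) (T-irrelevant xy xy′)

  edgeAdj-intro : ∀ {w f f′} → Incident w f → Incident w f′ → f ≢ f′ → T (edgeAdj {G = G} f f′)
  edgeAdj-intro {f = f@(x , y , _)} {f′@(x′ , y′ , _)} i i′ f≢f′ =
    from T-∧ (shares i i′ , T-not (f≢f′ ∘ sameEdge-sound f f′))
    where
    share : T (eqᵇ x x′) ⊎ T (eqᵇ x y′) ⊎ T (eqᵇ y x′) ⊎ T (eqᵇ y y′) → T (shareEndpoint {G = G} f f′)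
    share = T-∨₄
    shares : Incident _ f → Incident _ f′ → T (shareEndpoint {G = G} f f′)
    shares (inj₁ w≡x) (inj₁ w≡x′) = share (inj₁ (fromWitness (trans (sym w≡x) w≡x′)))
    shares (inj₁ w≡x) (inj₂ w≡y′) = share (inj₂ (inj₁ (fromWitness (trans (sym w≡x) w≡y′))))
    shares (inj₂ w≡y) (inj₁ w≡x′) = share (inj₂ (inj₂ (inj₁ (fromWitness (trans (sym w≡y) w≡x′)))))
    shares (inj₂ w≡y) (inj₂ w≡y′) = share (inj₂ (inj₂ (inj₂ (fromWitness (trans (sym w≡y) w≡y′)))))

  neighbours : Fin n → List (Fin n)
  neighbours w = filterᵇ (adj G w) (allFin n)

  sumFin-between-neighbours : ∀ g w → sumFin (between g w) ≡ sum (map (between g w) (neighbours w))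
  sumFin-between-neighbours g w = sym (trans (sum-map-filterᵇ (adj G w) (between g w) (allFin n))
                                             (sumFin-cong λ y → when-self (adj G w y) (between-nonadjacent g)))

  module _ {d} (regular : Regular d G) (c : Edge G → ℕ) (c∈[1,d] : EdgeLabelsIn {G = G} d c)
           (proper : ProperEdgeColoring G c) where

    sumFin-between-regular : ∀ w → sumFin (between c w) ≡ triangular d
    sumFin-between-regular w = trans (sumFin-between-neighbours c w)
      (sum-distinct-in-range d distinct inRange (trans (length-map _ (neighbours w)) (regular w)))
      where
      adjacent : All (T ∘ adj G w) (neighbours w)
      adjacent = all-filter (T? ∘ adj G w) (allFin n)

      inRange : InRange d (map (between c w) (neighbours w))
      inRange = all-map⁺ (All.map (λ {y} a → subst (λ k → 1 ≤ k × k ≤ d) (sym (between-edgeBetween c w y a))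
                                                 (c∈[1,d] _))
                                  adjacent)

      colours-differ : ∀ {y y′} → T (adj G w y) → T (adj G w y′) → y ≢ y′ → between c w y ≢ between c w y′
      colours-differ {y} {y′} a a′ y≢y′ eq = proper (edgeBetween w y a) (edgeBetween w y′ a′)
        (edgeAdj-intro (incident-edgeBetween w y a) (incident-edgeBetween w y′ a′)
                       (y≢y′ ∘ edgeBetween-injective w a a′))
        (begin
          c (edgeBetween w y a)    ≡⟨ between-edgeBetween c w y a ⟨
          between c w y            ≡⟨ eq ⟩
          between c w y′           ≡⟨ between-edgeBetween c w y′ a′ ⟩
          c (edgeBetween w y′ a′)  ∎)
        where open ≡-Reasoning

      distinct : Unique (map (between c w) (neighbours w))
      distinct = AllPairs.map⁺ (AllPairs-under colours-differ adjacent
                                               (Unique.filter⁺ (T? ∘ adj G w) (allFin⁺ n)))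

    sum-N′-regular : ∀ e → sum (map c (N' G e)) + (c e + c e) ≡ triangular d + triangular d
    sum-N′-regular e = trans (sum-N′ c e)
      (cong₂ _+_ (sumFin-between-regular (src {G = G} e)) (sumFin-between-regular (tgt {G = G} e)))

    proper⇒additive : AdditiveEdgeColoring G c
    proper⇒additive e f e~f sums≡ =
      proper e f e~f (+-double-injective (+-cancelˡ-≡ (sum (map c (N' G e))) _ _ (begin
        sum (map c (N' G e)) + (c e + c e) ≡⟨ sum-N′-regular e ⟩
        triangular d + triangular d        ≡⟨ sum-N′-regular f ⟨
        sum (map c (N' G f)) + (c f + c f) ≡⟨ cong (_+ (c f + c f)) sums≡ ⟨
        sum (map c (N' G e)) + (c f + c f) ∎)))
      where open ≡-Reasoning

-- Colourings of L(G) are definitionally edge colourings of G,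
-- and its neighbourhoods are the sets N'(e).
theorem2p1 : ∀ {n : ℕ} (d : ℕ) (G : SimpleGraph n) →
    1 ≤ d → Regular d G → ChromaticIndexIs G d →
    ((∀ (c : Edge G → ℕ) → EdgeLabelsIn {G = G} d c → ProperEdgeColoring G c →
        AdditiveEdgeColoring G c)
    × ProperAdditiveIndexIs G d
    × (∀ (a b : ℕ) → AdditiveNumberIs (LineGraph G) a →
        ChromaticNumberIs (LineGraph G) b → a ≤ b))
theorem2p1 d G _ regular ((c , c∈[1,d] , proper) , χ′-least) =
    proper⇒additive G regular
  , ((c , c∈[1,d] , proper , additive) ,
     λ k (c′ , c′∈[1,k] , proper′ , _) → χ′-least k (c′ , c′∈[1,k] , proper′))
  , λ a b (_ , η-least) (colouring , _) → ≤-trans (η-least d (c , c∈[1,d] , additive)) (χ′-least b colouring)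
  where
  additive : AdditiveEdgeColoring G c
  additive = proper⇒additive G regular c c∈[1,d] proper
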